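{- Let $f(x)=x^4+ax^3+bx^2+cx+d$ with $a,b,c,d\in\mathbb{Q}$. If $8c-4ab+a^3\neq 0$, then $f$ is not $2$-superirreducible over $\mathbb{Q}$.
   Context: For a commutative integral domain $I$ and $k\in\mathbb{N}$, a polynomial $f\in I[x]$ is called $k$-superirreducible over $I$ if $f$ is irreducible in $I[x]$ and, for every non-constant polynomial $g\in I[x]$ of degree at most $k$, the composition $f(g(x))$ is irreducible in $I[x]$. -}

module Defs where

open import Data.Nat using (ℕ; zero; suc; _≤_; _<_)
open import Data.Integer using (+_)
open import Data.Rational using (ℚ; 0ℚ; 1ℚ; _+_; _*_; _-_; _/_)
open import Data.List using (List; []; _∷_)
open import Data.Product using (Σ; _×_; ∃; ∃-syntax)
open import Data.Sum using (_⊎_)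
open import Relation.Binary.PropositionalEquality using (_≡_; _≢_)
open import Relation.Nullary using (¬_)

-- Polynomials in ℚ[x] as coefficient lists, constant term first.
-- Trailing zeros are allowed; equality of polynomials is coefficientwise (_≈ₚ_).
Poly : Set
Poly = List ℚ

coeff : Poly → ℕ → ℚ
coeff []       n       = 0ℚ
coeff (a ∷ p)  zero    = a
coeff (a ∷ p)  (suc n) = coeff p n

infix 4 _≈ₚ_
_≈ₚ_ : Poly → Poly → Set
p ≈ₚ q = ∀ n → coeff p n ≡ coeff q n

infixl 6 _+ₚ_
_+ₚ_ : Poly → Poly → Poly
[]      +ₚ q       = q
(a ∷ p) +ₚ []      = a ∷ p
(a ∷ p) +ₚ (b ∷ q) = (a + b) ∷ (p +ₚ q)

scale : ℚ → Poly → Poly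
scale c []      = []
scale c (a ∷ p) = (c * a) ∷ scale c p

infixl 7 _*ₚ_
_*ₚ_ : Poly → Poly → Poly
[]      *ₚ q = []
(a ∷ p) *ₚ q = scale a q +ₚ (0ℚ ∷ (p *ₚ q))

_∘ₚ_ : Poly → Poly → Poly
[]      ∘ₚ g = []
(a ∷ p) ∘ₚ g = (a ∷ []) +ₚ (g *ₚ (p ∘ₚ g))

oneₚ : Poly
oneₚ = 1ℚ ∷ []

zeroₚ : Poly
zeroₚ = []

HasDegree : Poly → ℕ → Set
HasDegree p n = coeff p n ≢ 0ℚ × (∀ m → n < m → coeff p m ≡ 0ℚ)

IsUnit : Poly → Set
IsUnit p = ∃[ q ] (p *ₚ q ≈ₚ oneₚ)

Irreducible : Poly → Set
Irreducible f =
  ¬ (f ≈ₚ zeroₚ) × ¬ IsUnit f ×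
  (∀ g h → f ≈ₚ g *ₚ h → IsUnit g ⊎ IsUnit h)

SuperIrreducible : ℕ → Poly → Set
SuperIrreducible k f =
  Irreducible f ×
  (∀ g n → 1 ≤ n → n ≤ k → HasDegree g n → Irreducible (f ∘ₚ g))

quartic : ℚ → ℚ → ℚ → ℚ → Poly
quartic a b c d = d ∷ c ∷ b ∷ a ∷ 1ℚ ∷ []

8ℚ 4ℚ : ℚ
8ℚ = + 8 / 1
4ℚ = + 4 / 1

-- Substituting x = y − a/4 depresses f to y⁴ + p y² + q y + r, where
-- 8q = 8c − 4ab + a³ ≠ 0. Writing r = p²/4 − q m,
--   y⁴ + p y² + q y + r = (y² + p/2)² + q (y − m),
-- and the quadratic substitution y = m − q x² turns q (y − m) into −(q x)²:
--   f(m − a/4 − q x²) = (y² + p/2 − q x)(y² + p/2 + q x),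
-- a product of two quartics in x.
module Submission where

open import Defs
open import Level using (0ℓ)
open import Data.Unit using (⊤; tt)
open import Data.Nat as ℕ using (ℕ; zero; suc; _<_; _≤_; z≤n; s≤s)
open import Data.Nat.Properties using (m≤n+m)
open import Data.Integer using (+_)
open import Data.List using (List; []; _∷_; _∷ʳ_; length)
open import Data.Rational using (ℚ; 0ℚ; 1ℚ; _+_; _*_; _-_; -_; _/_; ½; 1/_; ≢-nonZero)
open import Data.Rational.Properties
  using (+-*-commutativeRing; _≟_; 1≢0; neg-injective; +-identityˡ; +-identityʳ;
         *-zeroˡ; *-zeroʳ; *-identityˡ; *-assoc; *-inverseˡ; *-inverseʳ)
open import Data.Product using (_×_; ∃; _,_; proj₁; proj₂)
open import Data.Sum using (_⊎_; inj₁; inj₂; [_,_]′)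
open import Function using (_∘_)
open import Relation.Nullary using (¬_)
open import Relation.Nullary.Decidable using (yes; no; dec⇒maybe)
open import Relation.Binary.PropositionalEquality
open import Tactic.RingSolver using (solve-∀; solve)
open import Tactic.RingSolver.Core.AlmostCommutativeRing
  using (AlmostCommutativeRing; fromCommutativeRing)

ℚ-ring : AlmostCommutativeRing 0ℓ 0ℓ
ℚ-ring = fromCommutativeRing +-*-commutativeRing (λ x → dec⇒maybe (0ℚ ≟ x))

p*q≢0 : ∀ {p q} → p ≢ 0ℚ → q ≢ 0ℚ → p * q ≢ 0ℚ
p*q≢0 {p} {q} p≢0 q≢0 pq≡0 = q≢0 (begin
  q                ≡⟨ sym (*-identityˡ q) ⟩
  1ℚ * q           ≡⟨ cong (_* q) (sym (*-inverseˡ p)) ⟩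
  (1/ p) * p * q   ≡⟨ *-assoc (1/ p) p q ⟩
  (1/ p) * (p * q) ≡⟨ cong ((1/ p) *_) pq≡0 ⟩
  (1/ p) * 0ℚ      ≡⟨ *-zeroʳ (1/ p) ⟩
  0ℚ               ∎)
  where
  open ≡-Reasoning
  instance _ = ≢-nonZero p≢0

DegreeAtMost : Poly → ℕ → Set
DegreeAtMost p n = ∀ m → n < m → coeff p m ≡ 0ℚ

coeff-+ₚ : ∀ p q n → coeff (p +ₚ q) n ≡ coeff p n + coeff q n
coeff-+ₚ []      q       n       = sym (+-identityˡ (coeff q n))
coeff-+ₚ (x ∷ p) []      n       = sym (+-identityʳ (coeff (x ∷ p) n))
coeff-+ₚ (x ∷ p) (y ∷ q) zero    = refl
coeff-+ₚ (x ∷ p) (y ∷ q) (suc n) = coeff-+ₚ p q n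

coeff-scale : ∀ c p n → coeff (scale c p) n ≡ c * coeff p n
coeff-scale c []      n       = sym (*-zeroʳ c)
coeff-scale c (x ∷ p) zero    = refl
coeff-scale c (x ∷ p) (suc n) = coeff-scale c p n

coeff-∷-*ₚ : ∀ x p q n → coeff ((x ∷ p) *ₚ q) n ≡ x * coeff q n + coeff (0ℚ ∷ p *ₚ q) n
coeff-∷-*ₚ x p q n = trans (coeff-+ₚ (scale x q) (0ℚ ∷ p *ₚ q) n)
                           (cong (_+ coeff (0ℚ ∷ p *ₚ q) n) (coeff-scale x q n))

0∷-zero : ∀ {p} → p ≈ₚ zeroₚ → 0ℚ ∷ p ≈ₚ zeroₚ
0∷-zero p≈0 zero    = refl
0∷-zero p≈0 (suc n) = p≈0 n

*ₚ-zeroˡ : ∀ p q → p ≈ₚ zeroₚ → p *ₚ q ≈ₚ zeroₚ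
*ₚ-zeroˡ []      q p≈0 n = refl
*ₚ-zeroˡ (x ∷ p) q p≈0 n = begin
  coeff ((x ∷ p) *ₚ q) n                ≡⟨ coeff-∷-*ₚ x p q n ⟩
  x * coeff q n + coeff (0ℚ ∷ p *ₚ q) n ≡⟨ cong₂ _+_ (cong (_* coeff q n) (p≈0 zero))
                                                     (0∷-zero (*ₚ-zeroˡ p q (p≈0 ∘ suc)) n) ⟩
  0ℚ * coeff q n + 0ℚ                   ≡⟨ cong (_+ 0ℚ) (*-zeroˡ (coeff q n)) ⟩
  0ℚ                                    ∎
  where open ≡-Reasoning

*ₚ-zeroʳ : ∀ p q → q ≈ₚ zeroₚ → p *ₚ q ≈ₚ zeroₚ
*ₚ-zeroʳ []      q q≈0 n = refl
*ₚ-zeroʳ (x ∷ p) q q≈0 n = begin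
  coeff ((x ∷ p) *ₚ q) n                ≡⟨ coeff-∷-*ₚ x p q n ⟩
  x * coeff q n + coeff (0ℚ ∷ p *ₚ q) n ≡⟨ cong₂ _+_ (cong (x *_) (q≈0 n))
                                                     (0∷-zero (*ₚ-zeroʳ p q q≈0) n) ⟩
  x * 0ℚ + 0ℚ                           ≡⟨ cong (_+ 0ℚ) (*-zeroʳ x) ⟩
  0ℚ                                    ∎
  where open ≡-Reasoning

coeff-*ₚ-top : ∀ p q {m n} → DegreeAtMost p m → DegreeAtMost q n →
               coeff (p *ₚ q) (m ℕ.+ n) ≡ coeff p m * coeff q n
coeff-*ₚ-top []      q {m}     {n} p≤m q≤n = sym (*-zeroˡ (coeff q n))
coeff-*ₚ-top (x ∷ p) q {zero}  {n} p≤m q≤n = begin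
  coeff ((x ∷ p) *ₚ q) n                ≡⟨ coeff-∷-*ₚ x p q n ⟩
  x * coeff q n + coeff (0ℚ ∷ p *ₚ q) n ≡⟨ cong (_+_ (x * coeff q n)) (0∷-zero p*q≈0 n) ⟩
  x * coeff q n + 0ℚ                    ≡⟨ +-identityʳ (x * coeff q n) ⟩
  x * coeff q n                         ∎
  where
  open ≡-Reasoning
  p*q≈0 : p *ₚ q ≈ₚ zeroₚ
  p*q≈0 = *ₚ-zeroˡ p q (λ j → p≤m (suc j) (s≤s z≤n))
coeff-*ₚ-top (x ∷ p) q {suc m} {n} p≤m q≤n = begin
  coeff ((x ∷ p) *ₚ q) (suc (m ℕ.+ n))                   ≡⟨ coeff-∷-*ₚ x p q (suc (m ℕ.+ n)) ⟩
  x * coeff q (suc (m ℕ.+ n)) + coeff (p *ₚ q) (m ℕ.+ n) ≡⟨ cong₂ _+_ (cong (x *_) (q≤n _ (s≤s (m≤n+m n m))))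
                                                                     (coeff-*ₚ-top p q (λ j → p≤m (suc j) ∘ s≤s) q≤n) ⟩
  x * 0ℚ + coeff p m * coeff q n                         ≡⟨ cong (_+ coeff p m * coeff q n) (*-zeroʳ x) ⟩
  0ℚ + coeff p m * coeff q n                             ≡⟨ +-identityˡ (coeff p m * coeff q n) ⟩
  coeff p m * coeff q n                                  ∎
  where open ≡-Reasoning

zero-or-hasDegree : ∀ p → p ≈ₚ zeroₚ ⊎ ∃ (HasDegree p)
zero-or-hasDegree []      = inj₁ (λ _ → refl)
zero-or-hasDegree (x ∷ p) with zero-or-hasDegree p | x ≟ 0ℚ
... | inj₂ (n , pₙ≢0 , p≤n) | _       = inj₂ (suc n , pₙ≢0 , λ { (suc j) (s≤s n<j) → p≤n j n<j })
... | inj₁ p≈0              | yes x≡0 = inj₁ (λ { zero → x≡0 ; (suc j) → p≈0 j })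
... | inj₁ p≈0              | no x≢0  = inj₂ (zero , x≢0 , λ { (suc j) _ → p≈0 j })

hasDegree-∷ʳ : ∀ p {x} → x ≢ 0ℚ → HasDegree (p ∷ʳ x) (length p)
hasDegree-∷ʳ []      x≢0 = x≢0 , λ { (suc j) _ → refl }
hasDegree-∷ʳ (y ∷ p) x≢0 with hasDegree-∷ʳ p x≢0
... | top≢0 , bounded = top≢0 , λ { (suc j) (s≤s n<j) → bounded j n<j }

-- The leading coefficients of p and of an inverse would multiply to a nonzero
-- coefficient of 1 in positive degree.
hasPositiveDegree⇒¬unit : ∀ {p n} → HasDegree p (suc n) → ¬ IsUnit p
hasPositiveDegree⇒¬unit {p} {n} (pₙ≢0 , p≤n) (q , pq≈1) with zero-or-hasDegree q
... | inj₁ q≈0              = 1≢0 (trans (sym (pq≈1 zero)) (*ₚ-zeroʳ p q q≈0 zero))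
... | inj₂ (m , qₘ≢0 , q≤m) =
  p*q≢0 pₙ≢0 qₘ≢0 (trans (sym (coeff-*ₚ-top p q p≤n q≤m)) (pq≈1 (suc (n ℕ.+ m))))

∘-factorises⇒¬superIrreducible :
  ∀ {k n i j} f g h₁ h₂ → 1 ≤ n → n ≤ k → HasDegree g n →
  HasDegree h₁ (suc i) → HasDegree h₂ (suc j) → f ∘ₚ g ≈ₚ h₁ *ₚ h₂ →
  ¬ SuperIrreducible k f
∘-factorises⇒¬superIrreducible f g h₁ h₂ 1≤n n≤k g°n h₁° h₂° f∘g≈h₁h₂ (_ , irreducible-∘)
  with irreducible-∘ g _ 1≤n n≤k g°n
... | _ , _ , unit-factor =
  [ hasPositiveDegree⇒¬unit {h₁} h₁° , hasPositiveDegree⇒¬unit {h₂} h₂° ]′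
    (unit-factor h₁ h₂ f∘g≈h₁h₂)

-- Computes to the list of coefficient equations, each a goal the ring solver can read.
Coeffwise : Poly → Poly → Set
Coeffwise []      []      = ⊤
Coeffwise []      (y ∷ q) = 0ℚ ≡ y × Coeffwise [] q
Coeffwise (x ∷ p) []      = x ≡ 0ℚ × Coeffwise p []
Coeffwise (x ∷ p) (y ∷ q) = x ≡ y × Coeffwise p q

coeffwise⇒≈ₚ : ∀ p q → Coeffwise p q → p ≈ₚ q
coeffwise⇒≈ₚ []      []      _       n       = refl
coeffwise⇒≈ₚ []      (y ∷ q) (e , _) zero    = e
coeffwise⇒≈ₚ []      (y ∷ q) (_ , r) (suc n) = coeffwise⇒≈ₚ [] q r n
coeffwise⇒≈ₚ (x ∷ p) []      (e , _) zero    = e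
coeffwise⇒≈ₚ (x ∷ p) []      (_ , r) (suc n) = coeffwise⇒≈ₚ p [] r n
coeffwise⇒≈ₚ (x ∷ p) (y ∷ q) (e , _) zero    = e
coeffwise⇒≈ₚ (x ∷ p) (y ∷ q) (_ , r) (suc n) = coeffwise⇒≈ₚ p q r n

¼ : ℚ
¼ = + 1 / 4

depressedP : ℚ → ℚ → ℚ
depressedP a b = b - + 3 / 8 * a * a

depressedQ : ℚ → ℚ → ℚ → ℚ
depressedQ a b c = c - ½ * a * b + + 1 / 8 * a * a * a

depressedR : ℚ → ℚ → ℚ → ℚ → ℚ
depressedR a b c d = d - ¼ * a * c + + 1 / 16 * a * a * b - + 3 / 256 * a * a * a * a

-- y⁴ + p y² + q y + r at y = x + a/4
shiftedDepressed : ℚ → ℚ → ℚ → ℚ → Poly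
shiftedDepressed a p q r =
  quartic a (p + + 3 / 8 * a * a) (q + ½ * a * p + + 1 / 16 * a * a * a)
          (r + ¼ * a * q + + 1 / 16 * a * a * p + + 1 / 256 * a * a * a * a)

quartic≡shiftedDepressed : ∀ a b c d →
  quartic a b c d ≡ shiftedDepressed a (depressedP a b) (depressedQ a b c) (depressedR a b c d)
quartic≡shiftedDepressed a b c d = quartic-cong (shift-b a b) (shift-c a b c) (shift-d a b c d)
  where
  quartic-cong : ∀ {b b′ c c′ d d′} → b ≡ b′ → c ≡ c′ → d ≡ d′ → quartic a b c d ≡ quartic a b′ c′ d′
  quartic-cong refl refl refl = refl
  shift-b : ∀ a b → b ≡ (b - + 3 / 8 * a * a) + + 3 / 8 * a * a
  shift-b = solve-∀ ℚ-ring
  shift-c : ∀ a b c → c ≡ (c - ½ * a * b + + 1 / 8 * a * a * a) + ½ * a * (b - + 3 / 8 * a * a) + + 1 / 16 * a * a * a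
  shift-c = solve-∀ ℚ-ring
  shift-d : ∀ a b c d →
    d ≡ (d - ¼ * a * c + + 1 / 16 * a * a * b - + 3 / 256 * a * a * a * a)
        + ¼ * a * (c - ½ * a * b + + 1 / 8 * a * a * a) + + 1 / 16 * a * a * (b - + 3 / 8 * a * a)
        + + 1 / 256 * a * a * a * a
  shift-d = solve-∀ ℚ-ring

-- y² + p/2 + l x at y = m − q x²
quarticFactor : ℚ → ℚ → ℚ → ℚ → Poly
quarticFactor p q m l = (m * m + ½ * p) ∷ l ∷ - (q * m + q * m) ∷ 0ℚ ∷ q * q ∷ []

shiftedDepressed-∘-factorises : ∀ a p q m →
  shiftedDepressed a p q (¼ * p * p - q * m) ∘ₚ ((m - ¼ * a) ∷ 0ℚ ∷ - q ∷ [])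
    ≈ₚ quarticFactor p q m (- q) *ₚ quarticFactor p q m q
shiftedDepressed-∘-factorises a p q m =
  coeffwise⇒≈ₚ (shiftedDepressed a p q (¼ * p * p - q * m) ∘ₚ ((m - ¼ * a) ∷ 0ℚ ∷ - q ∷ []))
               (quarticFactor p q m (- q) *ₚ quarticFactor p q m q)
    ( solve vars ℚ-ring , solve vars ℚ-ring , solve vars ℚ-ring , solve vars ℚ-ring
    , solve vars ℚ-ring , solve vars ℚ-ring , solve vars ℚ-ring , solve vars ℚ-ring
    , solve vars ℚ-ring , solve vars ℚ-ring , solve vars ℚ-ring , tt)
  where
  vars : List ℚ
  vars = a ∷ p ∷ q ∷ m ∷ []

quarticFactor-degree : ∀ p q m l → q ≢ 0ℚ → HasDegree (quarticFactor p q m l) 4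
quarticFactor-degree p q m l q≢0 =
  hasDegree-∷ʳ ((m * m + ½ * p) ∷ l ∷ - (q * m + q * m) ∷ 0ℚ ∷ []) (p*q≢0 q≢0 q≢0)

k-q*x≡r-solvable : ∀ {q} k r → q ≢ 0ℚ → ∃ λ x → k - q * x ≡ r
k-q*x≡r-solvable {q} k r q≢0 = (k - r) * 1/ q , (begin
  k - q * ((k - r) * 1/ q)  ≡⟨ regroup k r q (1/ q) ⟩
  k - (k - r) * (q * 1/ q)  ≡⟨ cong (λ t → k - (k - r) * t) (*-inverseʳ q) ⟩
  k - (k - r) * 1ℚ          ≡⟨ cancel k r ⟩
  r                         ∎)
  where
  open ≡-Reasoning
  instance _ = ≢-nonZero q≢0
  regroup : ∀ k r q e → k - q * ((k - r) * e) ≡ k - (k - r) * (q * e)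
  regroup = solve-∀ ℚ-ring
  cancel : ∀ k r → k - (k - r) * 1ℚ ≡ r
  cancel = solve-∀ ℚ-ring

depressedQ≢0 : ∀ a b c → 8ℚ * c - 4ℚ * a * b + a * a * a ≢ 0ℚ → depressedQ a b c ≢ 0ℚ
depressedQ≢0 a b c disc≢0 q≡0 = disc≢0 (begin
  8ℚ * c - 4ℚ * a * b + a * a * a ≡⟨ disc≡8q a b c ⟩
  8ℚ * depressedQ a b c           ≡⟨ cong (8ℚ *_) q≡0 ⟩
  8ℚ * 0ℚ                         ≡⟨ *-zeroʳ 8ℚ ⟩
  0ℚ                              ∎)
  where
  open ≡-Reasoning
  disc≡8q : ∀ a b c → 8ℚ * c - 4ℚ * a * b + a * a * a ≡ 8ℚ * (c - ½ * a * b + + 1 / 8 * a * a * a)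
  disc≡8q = solve-∀ ℚ-ring

corollary5p2 : (a b c d : ℚ) →
    (8ℚ * c - 4ℚ * a * b + a * a * a) ≢ 0ℚ →
    ¬ SuperIrreducible 2 (quartic a b c d)
corollary5p2 a b c d disc≢0 =
  ∘-factorises⇒¬superIrreducible (quartic a b c d) g F₋ F₊ (s≤s z≤n) (s≤s (s≤s z≤n))
    (hasDegree-∷ʳ ((m - ¼ * a) ∷ 0ℚ ∷ []) (q≢0 ∘ neg-injective))
    (quarticFactor-degree p q m (- q) q≢0) (quarticFactor-degree p q m q q≢0)
    (subst (λ f → f ∘ₚ g ≈ₚ F₋ *ₚ F₊) (sym f≡shifted) (shiftedDepressed-∘-factorises a p q m))
  where
  p q m : ℚ
  p = depressedP a b
  q = depressedQ a b c
  q≢0 : q ≢ 0ℚ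
  q≢0 = depressedQ≢0 a b c disc≢0
  k-q*m≡r : ∃ λ m → ¼ * p * p - q * m ≡ depressedR a b c d
  k-q*m≡r = k-q*x≡r-solvable (¼ * p * p) (depressedR a b c d) q≢0
  m = proj₁ k-q*m≡r
  g F₋ F₊ : Poly
  g  = (m - ¼ * a) ∷ 0ℚ ∷ - q ∷ []
  F₋ = quarticFactor p q m (- q)
  F₊ = quarticFactor p q m q
  f≡shifted : quartic a b c d ≡ shiftedDepressed a p q (¼ * p * p - q * m)
  f≡shifted = trans (quartic≡shiftedDepressed a b c d) (cong (shiftedDepressed a p q) (sym (proj₂ k-q*m≡r)))
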